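{- Let $H(x,y,z)=2x^4+y^4+z^4\in\mathbb{F}_5[x,y,z]$. Then for any $A,B,C,D,E,F,G\in\mathbb{F}_5$ with $G\neq 0$, the form \[g(x,y,z,w):=H(x,y,z)+(Axy+Bxz+Cyz)w^2+(Dx+Ey+Fz)w^3+Gw^4\] has at least one non-singular zero over $\mathbb{F}_5$.
   Context: A non-singular zero of a form over $\mathbb{F}_5$ is a non-zero vector over $\mathbb{F}_5$ at which the form vanishes but not all of its partial derivatives vanish. -}

module Defs where

open import Data.Nat using (ℕ; zero; suc; _∸_)
open import Data.Fin using (Fin; zero; suc; toℕ; _≟_)
open import Data.Fin.Base using (fromℕ<)
open import Data.Nat.DivMod using (_%_; m%n<n)
open import Data.List using (List; []; _∷_; map; foldr)
open import Data.Product using (_×_; _,_; Σ; ∃)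
open import Relation.Binary.PropositionalEquality using (_≡_; _≢_)
open import Relation.Nullary using (¬_; yes; no)
import Data.Nat as ℕ

F₅ : Set
F₅ = Fin 5

toF : ℕ → F₅
toF n = fromℕ< (m%n<n n 5)

infixl 6 _+F_
infixl 7 _*F_
_+F_ : F₅ → F₅ → F₅
a +F b = toF (toℕ a ℕ.+ toℕ b)

_*F_ : F₅ → F₅ → F₅
a *F b = toF (toℕ a ℕ.* toℕ b)

0F : F₅
0F = zero

_^F_ : F₅ → ℕ → F₅
a ^F zero = toF 1
a ^F suc n = a *F (a ^F n)

Monomial : ℕ → Set
Monomial n = Fin n → ℕ

Poly : ℕ → Set
Poly n = List (F₅ × Monomial n)

evalMono : ∀ {n} → Monomial n → (Fin n → F₅) → F₅
evalMono {zero} e v = toF 1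
evalMono {suc n} e v = (v zero ^F e zero) *F evalMono {n} (λ i → e (suc i)) (λ i → v (suc i))

eval : ∀ {n} → Poly n → (Fin n → F₅) → F₅
eval p v = foldr (λ { (c , e) acc → (c *F evalMono e v) +F acc }) 0F p

∂ : ∀ {n} → Fin n → Poly n → Poly n
∂ i p = map (λ { (c , e) → (c *F toF (e i)) ,
                 (λ j → lower j (e j)) }) p
  where
    lower : _ → ℕ → ℕ
    lower j k with j ≟ i
    ... | yes _ = k ∸ 1
    ... | no _  = k

NonSingularZero : ∀ {n} → Poly n → (Fin n → F₅) → Set
NonSingularZero {n} p v =
  (¬ (∀ i → v i ≡ 0F)) × (eval p v ≡ 0F) × (¬ (∀ i → eval (∂ i p) v ≡ 0F))

-- variables x,y,z,w = 0,1,2,3 ; monomial x^a y^b z^c w^d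
mono : ℕ → ℕ → ℕ → ℕ → Monomial 4
mono a b c d zero = a
mono a b c d (suc zero) = b
mono a b c d (suc (suc zero)) = c
mono a b c d (suc (suc (suc zero))) = d

g : (A B C D E F G : F₅) → Poly 4
g A B C D E F G =
  (toF 2 , mono 4 0 0 0) ∷ (toF 1 , mono 0 4 0 0) ∷ (toF 1 , mono 0 0 4 0) ∷
  (A , mono 1 1 0 2) ∷ (B , mono 1 0 1 2) ∷ (C , mono 0 1 1 2) ∷
  (D , mono 1 0 0 3) ∷ (E , mono 0 1 0 3) ∷ (F , mono 0 0 1 3) ∷
  (G , mono 0 0 0 4) ∷ []

{-# OPTIONS --safe #-}
module Submission where

-- The proof is an exhaustive check: for each of the 5⁶ · 4 parameter tuples with G ≠ 0 the
-- type checker finds a non-singular zero in the affine chart w = 1.  Nothing is lost by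
-- searching only there: a⁴ ∈ {0, 1} for every a ∈ F₅, so H has no non-trivial zero and
-- every zero of g has w ≠ 0.  To keep the search fast, evaluation over F₅ is replaced by
-- evaluation over ℕ followed by a single reduction mod 5.

open import Defs
open import Data.Fin using (Fin; zero; suc; toℕ; _≟_)
open import Data.Fin.Properties using (toℕ<n; toℕ-fromℕ<; toℕ-injective; all?; any?)
open import Data.Nat as ℕ using (ℕ; _+_; _*_; _^_; _%_)
open import Data.Nat.DivMod using (%-distribˡ-+; %-distribˡ-*; m<n⇒m%n≡m)
open import Data.Bool using (Bool; true; _∧_)
open import Data.List using ([]; _∷_; foldr)
open import Data.Product using (∃; _,_; proj₂)
open import Data.Vec using (Vec; []; _∷_)
open import Function using (_∘_)
open import Relation.Binary.PropositionalEquality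
  using (_≡_; _≢_; refl; sym; trans; cong; cong₂; module ≡-Reasoning)
open import Relation.Nullary using (¬_; Dec; does; yes; no; ¬?)
open import Relation.Nullary.Decidable using (map′; _×-dec_; _→-dec_)

open ≡-Reasoning

evalMonoℕ : ∀ {n} → Monomial n → (Fin n → ℕ) → ℕ
evalMonoℕ {ℕ.zero}  e v = 1
evalMonoℕ {ℕ.suc n} e v = v zero ^ e zero * evalMonoℕ (e ∘ suc) (v ∘ suc)

evalℕ : ∀ {n} → Poly n → (Fin n → ℕ) → ℕ
evalℕ p v = foldr (λ { (c , e) acc → toℕ c * evalMonoℕ e v + acc }) 0 p

toℕ≡toℕ%5 : (a : F₅) → toℕ a ≡ toℕ a % 5
toℕ≡toℕ%5 a = sym (m<n⇒m%n≡m (toℕ<n a))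

toℕ-+F : ∀ {a b} m n → toℕ a ≡ m % 5 → toℕ b ≡ n % 5 → toℕ (a +F b) ≡ (m + n) % 5
toℕ-+F {a} {b} m n a≡m b≡n = begin
  toℕ (toF (toℕ a + toℕ b))  ≡⟨ toℕ-fromℕ< _ ⟩
  (toℕ a + toℕ b) % 5        ≡⟨ cong₂ (λ i j → (i + j) % 5) a≡m b≡n ⟩
  (m % 5 + n % 5) % 5        ≡⟨ %-distribˡ-+ m n 5 ⟨
  (m + n) % 5                ∎

toℕ-*F : ∀ {a b} m n → toℕ a ≡ m % 5 → toℕ b ≡ n % 5 → toℕ (a *F b) ≡ (m * n) % 5
toℕ-*F {a} {b} m n a≡m b≡n = begin
  toℕ (toF (toℕ a * toℕ b))  ≡⟨ toℕ-fromℕ< _ ⟩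
  (toℕ a * toℕ b) % 5        ≡⟨ cong₂ (λ i j → (i * j) % 5) a≡m b≡n ⟩
  (m % 5 * (n % 5)) % 5      ≡⟨ %-distribˡ-* m n 5 ⟨
  (m * n) % 5                ∎

toℕ-^F : ∀ a k → toℕ (a ^F k) ≡ toℕ a ^ k % 5
toℕ-^F a ℕ.zero    = refl
toℕ-^F a (ℕ.suc k) = toℕ-*F (toℕ a) (toℕ a ^ k) (toℕ≡toℕ%5 a) (toℕ-^F a k)

toℕ-evalMono : ∀ {n} (e : Monomial n) (v : Fin n → F₅) →
               toℕ (evalMono e v) ≡ evalMonoℕ e (toℕ ∘ v) % 5
toℕ-evalMono {ℕ.zero}  e v = refl
toℕ-evalMono {ℕ.suc n} e v =
  toℕ-*F (toℕ (v zero) ^ e zero) (evalMonoℕ (e ∘ suc) (toℕ ∘ v ∘ suc))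
         (toℕ-^F (v zero) (e zero)) (toℕ-evalMono (e ∘ suc) (v ∘ suc))

toℕ-eval : ∀ {n} (p : Poly n) (v : Fin n → F₅) → toℕ (eval p v) ≡ evalℕ p (toℕ ∘ v) % 5
toℕ-eval []            v = refl
toℕ-eval ((c , e) ∷ p) v =
  toℕ-+F (toℕ c * evalMonoℕ e (toℕ ∘ v)) (evalℕ p (toℕ ∘ v))
         (toℕ-*F (toℕ c) (evalMonoℕ e (toℕ ∘ v)) (toℕ≡toℕ%5 c) (toℕ-evalMono e v))
         (toℕ-eval p v)

eval≡0? : ∀ {n} (p : Poly n) (v : Fin n → F₅) → Dec (eval p v ≡ 0F)
eval≡0? p v = map′ (toℕ-injective ∘ trans (toℕ-eval p v))
                   (trans (sym (toℕ-eval p v)) ∘ cong toℕ)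
                   (evalℕ p (toℕ ∘ v) % 5 ℕ.≟ 0)

nonSingular? : ∀ {n} (p : Poly n) (v : Fin n → F₅) → Dec (¬ (∀ i → eval (∂ i p) v ≡ 0F))
nonSingular? p v = ¬? (all? λ i → eval≡0? (∂ i p) v)

affine : F₅ → F₅ → F₅ → Fin 4 → F₅
affine x y z zero                   = x
affine x y z (suc zero)             = y
affine x y z (suc (suc zero))       = z
affine x y z (suc (suc (suc zero))) = toF 1

affine-nonzero : ∀ x y z → ¬ (∀ i → affine x y z i ≡ 0F)
affine-nonzero x y z affine≡0 with affine≡0 (suc (suc (suc zero)))
... | ()

HasAffineNonSingularZero : Poly 4 → Set
HasAffineNonSingularZero p = ∃ λ x → ∃ λ y → ∃ λ z → NonSingularZero p (affine x y z)

nonSingularZero-from-affine : ∀ {p} → HasAffineNonSingularZero p → ∃ (NonSingularZero p)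
nonSingularZero-from-affine (x , y , z , nsz) = affine x y z , nsz

hasAffineNonSingularZero? : (p : Poly 4) → Dec (HasAffineNonSingularZero p)
hasAffineNonSingularZero? p = any? λ x → any? λ y → any? λ z →
  map′ (affine-nonzero x y z ,_) proj₂
       (eval≡0? p (affine x y z) ×-dec nonSingular? p (affine x y z))

-- The enumeration of the parameters is a Boolean computation, reflected only afterwards:
-- normalising it as a Dec built with all? and _→-dec_ exhausts memory.
allFinᵇ : ∀ {n} → (Fin n → Bool) → Bool
allFinᵇ {ℕ.zero}  f = true
allFinᵇ {ℕ.suc n} f = f zero ∧ allFinᵇ (f ∘ suc)

allFinᵇ-sound : ∀ {n} (f : Fin n → Bool) → allFinᵇ f ≡ true → ∀ i → f i ≡ true
allFinᵇ-sound f all≡true zero    with f zero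
... | true = refl
allFinᵇ-sound f all≡true (suc i) with f zero
... | true = allFinᵇ-sound (f ∘ suc) all≡true i

allVecᵇ : ∀ {n} k → (Vec (Fin n) k → Bool) → Bool
allVecᵇ ℕ.zero    f = f []
allVecᵇ (ℕ.suc k) f = allFinᵇ λ a → allVecᵇ k (f ∘ (a ∷_))

allVecᵇ-sound : ∀ {n} k (f : Vec (Fin n) k → Bool) → allVecᵇ k f ≡ true → ∀ v → f v ≡ true
allVecᵇ-sound ℕ.zero    f all≡true []      = all≡true
allVecᵇ-sound (ℕ.suc k) f all≡true (a ∷ v) =
  allVecᵇ-sound k (f ∘ (a ∷_)) (allFinᵇ-sound _ all≡true a) v

fromDoes : {P : Set} (p? : Dec P) → does p? ≡ true → P
fromDoes (yes p) _  = p
fromDoes (no _)  ()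

allVecᵇ-dec-sound : ∀ {n} k {P : Vec (Fin n) k → Set} (P? : ∀ v → Dec (P v)) →
                    allVecᵇ k (λ v → does (P? v)) ≡ true → ∀ v → P v
allVecᵇ-dec-sound k P? all≡true v = fromDoes (P? v) (allVecᵇ-sound k _ all≡true v)

GHasAffineNonSingularZero : Vec F₅ 7 → Set
GHasAffineNonSingularZero (A ∷ B ∷ C ∷ D ∷ E ∷ F ∷ G ∷ []) =
  G ≢ 0F → HasAffineNonSingularZero (g A B C D E F G)

gHasAffineNonSingularZero? : ∀ params → Dec (GHasAffineNonSingularZero params)
gHasAffineNonSingularZero? (A ∷ B ∷ C ∷ D ∷ E ∷ F ∷ G ∷ []) =
  ¬? (G ≟ 0F) →-dec hasAffineNonSingularZero? (g A B C D E F G)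

allParameters-gHasAffineNonSingularZero :
  allVecᵇ 7 (λ v → does (gHasAffineNonSingularZero? v)) ≡ true
allParameters-gHasAffineNonSingularZero = refl

lemma12 : (A B C D E F G : F₅) → G ≢ 0F →
    ∃ λ (v : Fin 4 → F₅) → NonSingularZero (g A B C D E F G) v
lemma12 A B C D E F G G≢0 = nonSingularZero-from-affine {g A B C D E F G}
  (allVecᵇ-dec-sound 7 gHasAffineNonSingularZero? allParameters-gHasAffineNonSingularZero
    (A ∷ B ∷ C ∷ D ∷ E ∷ F ∷ G ∷ []) G≢0)
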